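{- For $n \geq 4$ and $k \geq 2$ we have $ex(n;k) = \lfloor \frac{n^2}{4} \rfloor$, and for $n \geq 7$ every $2$-geodetic digraph on $n$ vertices with $ex(n;2)$ arcs is an orientation of the complete balanced bipartite graph $K_{\lceil \frac{n}{2} \rceil, \lfloor \frac{n}{2} \rfloor}$.
   Context: A digraph has a vertex set and an arc set consisting of ordered pairs of distinct vertices. A walk of length $\ell$ is a sequence $x_0x_1\dots x_\ell$ of vertices with $x_i \rightarrow x_{i+1}$ for all $i$. A digraph is $k$-geodetic if for every ordered pair $(u,v)$ of (not necessarily distinct) vertices there is at most one $u,v$-walk of length at most $k$. For $n,k\ge 2$, $ex(n;k)$ is the largest possible number of arcs of a $k$-geodetic digraph on $n$ vertices. An orientation of an undirected graph is obtained by assigning a direction to each edge. -}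

module Defs where

open import Data.Nat using (ℕ; zero; suc; _≤_; _+_)
open import Data.Bool using (Bool; true; false; if_then_else_; _∧_; _∨_; _xor_)
open import Data.Fin using (Fin)
open import Data.List using (List; []; _∷_; length; map; allFin)
open import Data.Nat.ListAction using (sum)
open import Data.Product using (Σ; _×_; ∃)
open import Relation.Binary.PropositionalEquality using (_≡_)

record Digraph (n : ℕ) : Set where
  field
    arc    : Fin n → Fin n → Bool
    irrefl : ∀ x → arc x x ≡ false
open Digraph public

-- Walk G u v xs : the vertex sequence xs = x₀ x₁ … x_ℓ is a u,v-walk in G
-- (x₀ = u, x_ℓ = v, x_i → x_{i+1}).  Its length is ℓ = length xs ∸ 1.
data Walk {n : ℕ} (G : Digraph n) : Fin n → Fin n → List (Fin n) → Set where
  here : ∀ u → Walk G u u (u ∷ [])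
  step : ∀ {u w v xs} → arc G u w ≡ true → Walk G w v xs → Walk G u v (u ∷ xs)

-- k-geodetic: for every ordered pair (u,v) there is at most one u,v-walk of
-- length at most k (length ≤ k  ⇔  number of vertices ≤ suc k).
Geodetic : {n : ℕ} → ℕ → Digraph n → Set
Geodetic {n} k G = ∀ (u v : Fin n) (xs ys : List (Fin n)) →
  Walk G u v xs → Walk G u v ys →
  length xs ≤ suc k → length ys ≤ suc k → xs ≡ ys

arcCount : {n : ℕ} → Digraph n → ℕ
arcCount {n} G =
  sum (map (λ u → sum (map (λ v → if arc G u v then 1 else 0) (allFin n))) (allFin n))

IsEx : ℕ → ℕ → ℕ → Set
IsEx n k m =
  (Σ (Digraph n) λ G → Geodetic k G × arcCount G ≡ m) ×
  (∀ (G : Digraph n) → Geodetic k G → arcCount G ≤ m)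

countTrue : {n : ℕ} → (Fin n → Bool) → ℕ
countTrue {n} p = sum (map (λ v → if p v then 1 else 0) (allFin n))

countFalse : {n : ℕ} → (Fin n → Bool) → ℕ
countFalse {n} p = sum (map (λ v → if p v then 0 else 1) (allFin n))

IsOrientationOfKbip : {n : ℕ} → ℕ → ℕ → Digraph n → Set
IsOrientationOfKbip {n} a b G =
  Σ (Fin n → Bool) λ side →
    countTrue side ≡ a × countFalse side ≡ b ×
    (∀ (u v : Fin n) →
       (arc G u v ∨ arc G v u) ≡ (side u xor side v) ×
       (arc G u v ∧ arc G v u) ≡ false)

{-# OPTIONS --safe #-}
-- A k-geodetic digraph (k ≥ 2) has no 2-cycles, no transitive triangles and no two distinct paths
-- of length two with the same ends. So every triangle of its underlying graph is a directed
-- 3-cycle and every edge lies in at most one triangle. Without triangles, Mantel's theorem bounds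
-- the number of arcs by ⌊n/2⌋⌈n/2⌉. Otherwise each vertex outside a triangle is adjacent to at most
-- one of its vertices, so deleting the triangle loses at most 3 + (n − 3) arcs, and induction gives
-- the same bound (n = 3 being the exception). For n ≥ 7 the triangle case falls strictly short, so an
-- extremal digraph is triangle-free and the equality case of Mantel's theorem makes it an
-- orientation of K_{⌈n/2⌉,⌊n/2⌋}. Orienting all edges of that graph from one part to the other
-- attains the bound.
module Submission where

open import Data.Bool using (Bool; true; false; not; _∧_; _∨_; _xor_; if_then_else_)
open import Data.Bool.Properties
  using (∧-inverseʳ; ∨-comm; not-involutive; not-distribˡ-xor; not-distribʳ-xor; xor-comm; true-xor)
  renaming (_≟_ to _≟ᵇ_)
open import Data.Empty using (⊥; ⊥-elim)
open import Data.Fin using (Fin; zero; suc; toℕ; punchIn)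
open import Data.Fin.Properties using (_≟_; any?; punchInᵢ≢i)
open import Data.List using ([]; _∷_; map; allFin; tabulate)
open import Data.List.Properties using (map-tabulate)
open import Data.Nat
  using (ℕ; zero; suc; _+_; _*_; _/_; _%_; _≤_; _<_; _<ᵇ_; z≤n; s≤s; z<s; _≤?_; ⌊_/2⌋; ⌈_/2⌉)
open import Data.Nat.DivMod using (+-distrib-/-∣ʳ; m<n⇒m/n≡0; m%n<n; m*n/n≡m)
open import Data.Nat.Divisibility using (divides)
open import Data.Nat.Induction using (<-rec)
open import Data.Nat.ListAction using () renaming (sum to sumₗ)
open import Data.Nat.Properties hiding (_≟_)
open import Data.Nat.Tactic.RingSolver using (solve-∀)
open import Data.Product using (Σ; ∃; _×_; _,_; proj₁; proj₂)
open import Data.Sum using (_⊎_; inj₁; inj₂)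
open import Function using (_∘_)
open import Relation.Binary.PropositionalEquality
  using (_≡_; _≢_; refl; sym; trans; cong; cong₂; subst; module ≡-Reasoning)
open import Relation.Nullary using (Dec; yes; no; ¬_; does; contradiction)
open import Relation.Nullary.Decidable using (dec-true; dec-false; _×-dec_; map′)

open import Algebra.Properties.Semiring.Sum +-*-semiring
  using (sum; sum-cong-≗; ∑-distrib-+; sum-remove; sum-replicate-zero; *-distribʳ-sum)

open import Defs

private
  variable
    n m s : ℕ

𝟙 : Bool → ℕ
𝟙 b = if b then 1 else 0

𝟙≤1 : ∀ b → 𝟙 b ≤ 1
𝟙≤1 true  = ≤-refl
𝟙≤1 false = z≤n

𝟙-injective : ∀ {a b} → 𝟙 a ≡ 𝟙 b → a ≡ b
𝟙-injective {true}  {true}  _ = refl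
𝟙-injective {false} {false} _ = refl

𝟙-positive : ∀ {b} → 0 < 𝟙 b → b ≡ true
𝟙-positive {true} _ = refl

𝟙-+-≤ : ∀ a b → 𝟙 a + 𝟙 b ≤ 1 + 𝟙 (a ∧ b)
𝟙-+-≤ true  true  = ≤-refl
𝟙-+-≤ true  false = ≤-refl
𝟙-+-≤ false true  = ≤-refl
𝟙-+-≤ false false = z≤n

𝟙-∧-positive : ∀ a b → 0 < 𝟙 (a ∧ b) → a ≡ true × b ≡ true
𝟙-∧-positive true  true  _ = refl , refl
𝟙-∧-positive true  false ()
𝟙-∧-positive false _     ()

𝟙-not : ∀ b → 𝟙 (not b) ≡ (if b then 0 else 1)
𝟙-not true  = refl
𝟙-not false = refl

+-mono-≤-≡ : ∀ {a b c d} → a ≤ b → c ≤ d → a + c ≡ b + d → a ≡ b × c ≡ d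
+-mono-≤-≡ {a} {b} {c} {d} a≤b c≤d eq = a≡b , +-cancelˡ-≡ a c d (trans eq (cong (_+ d) (sym a≡b)))
  where
  a≡b : a ≡ b
  a≡b = ≤-antisym a≤b (+-cancelʳ-≤ d b a (subst (_≤ a + d) eq (+-monoʳ-≤ a c≤d)))

sum-mono-≤ : {f g : Fin m → ℕ} → (∀ i → f i ≤ g i) → sum f ≤ sum g
sum-mono-≤ {zero}  _   = z≤n
sum-mono-≤ {suc m} f≤g = +-mono-≤ (f≤g zero) (sum-mono-≤ (f≤g ∘ suc))

sum-mono-≤-≡ : {f g : Fin m → ℕ} → (∀ i → f i ≤ g i) → sum f ≡ sum g → ∀ i → f i ≡ g i
sum-mono-≤-≡ {suc m} f≤g eq i with +-mono-≤-≡ (f≤g zero) (sum-mono-≤ (f≤g ∘ suc)) eq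
sum-mono-≤-≡ {suc m} f≤g eq zero    | head≡ , _     = head≡
sum-mono-≤-≡ {suc m} f≤g eq (suc i) | _     , tail≡ = sum-mono-≤-≡ (f≤g ∘ suc) tail≡ i

sum-positive : (f : Fin m → ℕ) → 0 < sum f → ∃ λ i → 0 < f i
sum-positive {suc m} f pos with f zero in eq
... | suc _ = zero , subst (0 <_) (sym eq) z<s
... | zero with sum-positive (f ∘ suc) pos
...   | i , fi>0 = suc i , fi>0

sum-const-1 : ∀ m → sum {m} (λ _ → 1) ≡ m
sum-const-1 zero    = refl
sum-const-1 (suc m) = cong suc (sum-const-1 m)

sumₗ-allFin : (f : Fin m → ℕ) → sumₗ (map f (allFin m)) ≡ sum f
sumₗ-allFin {m} f = trans (cong sumₗ (map-tabulate (λ i → i) f)) (sum-tabulate f)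
  where
  sum-tabulate : ∀ {m} (f : Fin m → ℕ) → sumₗ (tabulate f) ≡ sum f
  sum-tabulate {zero}  f = refl
  sum-tabulate {suc m} f = cong (f zero +_) (sum-tabulate (f ∘ suc))

arcCount≡sum : (G : Digraph n) → arcCount G ≡ sum (λ u → sum (λ v → 𝟙 (arc G u v)))
arcCount≡sum {n} G = trans (sumₗ-allFin (λ u → sumₗ (map (λ v → 𝟙 (arc G u v)) (allFin n))))
                               (sum-cong-≗ λ u → sumₗ-allFin (λ v → 𝟙 (arc G u v)))

countTrue≡sum : (p : Fin n → Bool) → countTrue p ≡ sum (𝟙 ∘ p)
countTrue≡sum p = sumₗ-allFin (𝟙 ∘ p)

countFalse≡sum : (p : Fin n → Bool) → countFalse p ≡ sum (𝟙 ∘ not ∘ p)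
countFalse≡sum p = trans (sumₗ-allFin (λ v → if p v then 0 else 1)) (sum-cong-≗ λ v → sym (𝟙-not (p v)))

_[_↦_] : {A : Set} → (Fin n → A) → Fin n → A → Fin n → A
(f [ v ↦ b ]) y = if does (y ≟ v) then b else f y

[↦]-≡ : {A : Set} (f : Fin n → A) (v : Fin n) (b : A) → (f [ v ↦ b ]) v ≡ b
[↦]-≡ f v b rewrite dec-true (v ≟ v) refl = refl

[↦]-≢ : {A : Set} (f : Fin n → A) {v y : Fin n} (b : A) → y ≢ v → (f [ v ↦ b ]) y ≡ f y
[↦]-≢ f {v} {y} b y≢v rewrite dec-false (y ≟ v) y≢v = refl

sum-pick : (v : Fin n) (t : Fin n → ℕ) → sum t ≡ t v + sum (t [ v ↦ 0 ])
sum-pick {suc n} v t = begin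
  sum t                                ≡⟨ sum-remove {i = v} t ⟩
  t v + sum (t ∘ punchIn v)            ≡⟨ cong (t v +_) (sum-cong-≗ λ y → sym ([↦]-≢ t 0 (punchInᵢ≢i v y))) ⟩
  t v + sum (t′ ∘ punchIn v)           ≡⟨ cong (λ z → t v + (z + sum (t′ ∘ punchIn v))) ([↦]-≡ t v 0) ⟨
  t v + (t′ v + sum (t′ ∘ punchIn v))  ≡⟨ cong (t v +_) (sum-remove {i = v} t′) ⟨
  t v + sum t′                         ∎
  where
  open ≡-Reasoning
  t′ : Fin (suc n) → ℕ
  t′ = t [ v ↦ 0 ]

VertexSet : ℕ → Set
VertexSet n = Fin n → Bool

infixl 6 _─_

_─_ : VertexSet n → Fin n → VertexSet n
S ─ v = S [ v ↦ false ]

sumOver : VertexSet n → (Fin n → ℕ) → ℕ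
sumOver S a = sum (λ y → if S y then a y else 0)

size : VertexSet n → ℕ
size S = sumOver S (λ _ → 1)

countOn : VertexSet n → (Fin n → Bool) → ℕ
countOn S side = sumOver S (𝟙 ∘ side)

full : ∀ n → VertexSet n
full _ _ = true

size-full : ∀ n → size (full n) ≡ n
size-full = sum-const-1

module _ (S : VertexSet n) {v y : Fin n} where

  ─-⊆ : (S ─ v) y ≡ true → S y ≡ true
  ─-⊆ y∈ with y ≟ v
  ... | no _ = y∈

  ─-≢ : (S ─ v) y ≡ true → y ≢ v
  ─-≢ y∈ with y ≟ v
  ... | no y≢v = y≢v

  ─-intro : S y ≡ true → y ≢ v → (S ─ v) y ≡ true
  ─-intro y∈ y≢v = trans ([↦]-≢ S false y≢v) y∈

restrict-pointwise : (R : ℕ → ℕ → Set) → R 0 0 → (S : VertexSet n) {a b : Fin n → ℕ} →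
  (∀ {y} → S y ≡ true → R (a y) (b y)) → ∀ y → R (if S y then a y else 0) (if S y then b y else 0)
restrict-pointwise _ R00 S h y with S y in y∈
... | true  = h y∈
... | false = R00

sumOver-cong : (S : VertexSet n) {a b : Fin n → ℕ} →
  (∀ {y} → S y ≡ true → a y ≡ b y) → sumOver S a ≡ sumOver S b
sumOver-cong S {a} {b} h = sum-cong-≗ (restrict-pointwise _≡_ refl S {a} {b} h)

sumOver-mono-≤ : (S : VertexSet n) {a b : Fin n → ℕ} →
  (∀ {y} → S y ≡ true → a y ≤ b y) → sumOver S a ≤ sumOver S b
sumOver-mono-≤ S {a} {b} h = sum-mono-≤ (restrict-pointwise _≤_ z≤n S {a} {b} h)

sumOver-mono-≤-≡ : (S : VertexSet n) {a b : Fin n → ℕ} →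
  (∀ {y} → S y ≡ true → a y ≤ b y) → sumOver S a ≡ sumOver S b →
  ∀ {y} → S y ≡ true → a y ≡ b y
sumOver-mono-≤-≡ S {a} {b} h eq {y} y∈ =
  subst (λ c → (if c then a y else 0) ≡ (if c then b y else 0)) y∈
        (sum-mono-≤-≡ (restrict-pointwise _≤_ z≤n S {a} {b} h) eq y)

sumOver-+ : (S : VertexSet n) (a b : Fin n → ℕ) →
  sumOver S (λ y → a y + b y) ≡ sumOver S a + sumOver S b
sumOver-+ S a b =
  trans (sum-cong-≗ split) (∑-distrib-+ (λ y → if S y then a y else 0) (λ y → if S y then b y else 0))
  where
  split : ∀ y → (if S y then a y + b y else 0) ≡ (if S y then a y else 0) + (if S y then b y else 0)
  split y with S y
  ... | true  = refl
  ... | false = refl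

sumOver-─ : (S : VertexSet n) {v : Fin n} (a : Fin n → ℕ) → S v ≡ true →
  sumOver S a ≡ a v + sumOver (S ─ v) a
sumOver-─ S {v} a v∈ =
  trans (sum-pick v _) (cong₂ _+_ head (sum-cong-≗ tail))
  where
  head : (if S v then a v else 0) ≡ a v
  head rewrite v∈ = refl
  tail : ∀ y → ((λ y → if S y then a y else 0) [ v ↦ 0 ]) y ≡ (if (S ─ v) y then a y else 0)
  tail y with y ≟ v
  ... | yes _ = refl
  ... | no _  = refl

sumOver-positive : (S : VertexSet n) (a : Fin n → ℕ) → 0 < sumOver S a →
  ∃ λ y → S y ≡ true × 0 < a y
sumOver-positive S a pos with sum-positive _ pos
... | y , pos-y with S y in y∈
...   | true = y , y∈ , pos-y

size-─ : (S : VertexSet n) {v : Fin n} → S v ≡ true → size S ≡ suc (size (S ─ v))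
size-─ S = sumOver-─ S (λ _ → 1)

size≡suc⇒size-─≡ : (S : VertexSet n) {v : Fin n} → S v ≡ true → size S ≡ suc s → size (S ─ v) ≡ s
size≡suc⇒size-─≡ S v∈ size≡ = suc-injective (trans (sym (size-─ S v∈)) size≡)

size≡0⇒∉ : (S : VertexSet n) → size S ≡ 0 → ∀ y → S y ≡ false
size≡0⇒∉ S size≡0 y with S y in y∈
... | false = refl
... | true with trans (sym size≡0) (size-─ S y∈)
...   | ()

sumOver-empty : (S : VertexSet n) (a : Fin n → ℕ) → size S ≡ 0 → sumOver S a ≡ 0
sumOver-empty {n} S a size≡0 =
  trans (sum-cong-≗ λ y → cong (λ c → if c then a y else 0) (size≡0⇒∉ S size≡0 y))
        (sum-replicate-zero n)

size≡suc⇒∈ : (S : VertexSet n) → size S ≡ suc s → ∃ λ v → S v ≡ true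
size≡suc⇒∈ S size≡ with sumOver-positive S _ (subst (0 <_) (sym size≡) z<s)
... | v , v∈ , _ = v , v∈

-- The Mantel number ⌊s/2⌋⌈s/2⌉

mantel : ℕ → ℕ
mantel s = ⌊ s /2⌋ * ⌈ s /2⌉

mantel-suc : ∀ s → mantel (suc s) ≡ mantel s + ⌈ s /2⌉
mantel-suc s = shift ⌈ s /2⌉ ⌊ s /2⌋
  where
  shift : ∀ c f → c * suc f ≡ f * c + c
  shift = solve-∀

mantel-2+ : ∀ s → mantel (2 + s) ≡ mantel s + suc s
mantel-2+ s = begin
  mantel (2 + s)                        ≡⟨ mantel-suc (suc s) ⟩
  mantel (suc s) + suc ⌊ s /2⌋          ≡⟨ cong (_+ suc ⌊ s /2⌋) (mantel-suc s) ⟩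
  mantel s + ⌈ s /2⌉ + suc ⌊ s /2⌋      ≡⟨ +-assoc (mantel s) _ _ ⟩
  mantel s + (⌈ s /2⌉ + suc ⌊ s /2⌋)    ≡⟨ cong (mantel s +_) (+-suc ⌈ s /2⌉ ⌊ s /2⌋) ⟩
  mantel s + suc (⌈ s /2⌉ + ⌊ s /2⌋)    ≡⟨ cong (λ t → mantel s + suc t)
                                             (trans (+-comm ⌈ s /2⌉ ⌊ s /2⌋) (⌊n/2⌋+⌈n/2⌉≡n s)) ⟩
  mantel s + suc s                      ∎
  where open ≡-Reasoning

mantel-3+ : ∀ s → mantel (3 + s) ≡ mantel s + (⌈ s /2⌉ + (2 + s))
mantel-3+ s = trans (mantel-2+ (suc s)) (trans (cong (_+ (2 + s)) (mantel-suc s)) (+-assoc (mantel s) _ _))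

square≡mantel : ∀ n → n * n ≡ n % 2 + mantel n * 4
square≡mantel 0 = refl
square≡mantel 1 = refl
square≡mantel (suc (suc n)) = begin
  (2 + n) * (2 + n)                       ≡⟨ expand n ⟩
  n * n + suc n * 4                       ≡⟨ cong (_+ suc n * 4) (square≡mantel n) ⟩
  n % 2 + mantel n * 4 + suc n * 4        ≡⟨ +-assoc (n % 2) _ _ ⟩
  n % 2 + (mantel n * 4 + suc n * 4)      ≡⟨ cong (n % 2 +_) (*-distribʳ-+ 4 (mantel n) (suc n)) ⟨
  n % 2 + (mantel n + suc n) * 4          ≡⟨ cong (λ t → n % 2 + t * 4) (mantel-2+ n) ⟨
  n % 2 + mantel (2 + n) * 4              ∎
  where
  open ≡-Reasoning
  expand : ∀ n → (2 + n) * (2 + n) ≡ n * n + suc n * 4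
  expand = solve-∀

mantel≡square/4 : ∀ n → mantel n ≡ (n * n) / 4
mantel≡square/4 n = sym (begin
  (n * n) / 4                       ≡⟨ cong (_/ 4) (square≡mantel n) ⟩
  (n % 2 + mantel n * 4) / 4        ≡⟨ +-distrib-/-∣ʳ (n % 2) (divides (mantel n) refl) ⟩
  n % 2 / 4 + mantel n * 4 / 4      ≡⟨ cong₂ _+_ (m<n⇒m/n≡0 (≤-trans (m%n<n n 2) (s≤s (s≤s z≤n))))
                                                 (m*n/n≡m (mantel n) 4) ⟩
  mantel n                          ∎)
  where open ≡-Reasoning

n≤⌈n/2⌉+⌈n/2⌉ : ∀ n → n ≤ ⌈ n /2⌉ + ⌈ n /2⌉
n≤⌈n/2⌉+⌈n/2⌉ n = subst (_≤ ⌈ n /2⌉ + ⌈ n /2⌉) (⌊n/2⌋+⌈n/2⌉≡n n) (+-monoˡ-≤ ⌈ n /2⌉ (⌊n/2⌋≤⌈n/2⌉ n))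

mantel-3+-≤ : ∀ {k} s → k ≤ ⌈ s /2⌉ → mantel s + (k + (2 + s)) ≤ mantel (3 + s)
mantel-3+-≤ s k≤ = ≤-trans (+-monoʳ-≤ (mantel s) (+-monoˡ-≤ (2 + s) k≤)) (≤-reflexive (sym (mantel-3+ s)))

mantel-3+-< : ∀ s → 3 ≤ s → mantel s + (3 + s) < mantel (3 + s)
mantel-3+-< s 3≤s = subst (_≤ mantel (3 + s)) (+-suc (mantel s) (3 + s)) (mantel-3+-≤ s (⌈n/2⌉-mono 3≤s))

-- The directed triangle has 3 > mantel 3 arcs; every other size obeys Mantel's bound.
geodeticBound : ℕ → ℕ
geodeticBound 3 = 3
geodeticBound s = mantel s

mantel≤geodeticBound : ∀ s → mantel s ≤ geodeticBound s
mantel≤geodeticBound 0 = ≤-refl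
mantel≤geodeticBound 1 = ≤-refl
mantel≤geodeticBound 2 = ≤-refl
mantel≤geodeticBound 3 = m≤n⇒m≤1+n ≤-refl
mantel≤geodeticBound (suc (suc (suc (suc s)))) = ≤-refl

geodeticBound≡mantel : ∀ {s} → 4 ≤ s → geodeticBound s ≡ mantel s
geodeticBound≡mantel {1} (s≤s ())
geodeticBound≡mantel {2} (s≤s (s≤s ()))
geodeticBound≡mantel {3} (s≤s (s≤s (s≤s ())))
geodeticBound≡mantel {suc (suc (suc (suc s)))} _ = refl

geodeticBound-3+ : ∀ s → geodeticBound s + (3 + s) ≤ geodeticBound (3 + s)
geodeticBound-3+ 0 = ≤-refl
geodeticBound-3+ 1 = ≤-refl
geodeticBound-3+ 2 = ≤-refl
geodeticBound-3+ 3 = ≤-refl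
geodeticBound-3+ s@(suc (suc (suc (suc _)))) = mantel-3+-≤ s (⌈n/2⌉-mono {1} (s≤s z≤n))

-- Mantel's theorem and its equality case for orientations

Asymmetric : Digraph n → Set
Asymmetric G = ∀ {u v} → arc G u v ≡ true → arc G v u ≡ true → ⊥

module Orientation {n : ℕ} (G : Digraph n) (asym : Asymmetric G) where

  adj : Fin n → Fin n → Bool
  adj u v = arc G u v ∨ arc G v u

  adj-sym : ∀ u v → adj u v ≡ adj v u
  adj-sym u v = ∨-comm (arc G u v) (arc G v u)

  adj-irrefl : ∀ v → adj v v ≡ false
  adj-irrefl v rewrite irrefl G v = refl

  adj⇒≢ : ∀ {u v} → adj u v ≡ true → u ≢ v
  adj⇒≢ {u} uv refl with trans (sym uv) (adj-irrefl u)
  ... | ()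

  adj⇒arc : ∀ {u v} → adj u v ≡ true → arc G u v ≡ true ⊎ arc G v u ≡ true
  adj⇒arc {u} {v} uv with arc G u v
  ... | true  = inj₁ refl
  ... | false = inj₂ uv

  arc∧arc≡false : ∀ u v → (arc G u v ∧ arc G v u) ≡ false
  arc∧arc≡false u v with arc G u v in uv | arc G v u in vu
  ... | true  | true  = ⊥-elim (asym uv vu)
  ... | true  | false = refl
  ... | false | _     = refl

  𝟙-adj : ∀ u v → 𝟙 (adj u v) ≡ 𝟙 (arc G u v) + 𝟙 (arc G v u)
  𝟙-adj u v with arc G u v in uv | arc G v u in vu
  ... | true  | true  = ⊥-elim (asym uv vu)
  ... | true  | false = refl
  ... | false | _     = refl

  outdeg indeg deg : VertexSet n → Fin n → ℕ
  outdeg S u = sumOver S (λ w → 𝟙 (arc G u w))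
  indeg  S u = sumOver S (λ w → 𝟙 (arc G w u))
  deg    S u = sumOver S (λ w → 𝟙 (adj u w))

  arcs : VertexSet n → ℕ
  arcs S = sumOver S (outdeg S)

  deg≡outdeg+indeg : ∀ S u → deg S u ≡ outdeg S u + indeg S u
  deg≡outdeg+indeg S u =
    trans (sumOver-cong S λ {w} _ → 𝟙-adj u w) (sumOver-+ S (λ w → 𝟙 (arc G u w)) (λ w → 𝟙 (arc G w u)))

  outdeg-─-self : ∀ S {v} → S v ≡ true → outdeg S v ≡ outdeg (S ─ v) v
  outdeg-─-self S {v} v∈ rewrite sumOver-─ S (λ w → 𝟙 (arc G v w)) v∈ | irrefl G v = refl

  deg-─-self : ∀ S {v} → S v ≡ true → deg S v ≡ deg (S ─ v) v
  deg-─-self S {v} v∈ rewrite sumOver-─ S (λ w → 𝟙 (adj v w)) v∈ | adj-irrefl v = refl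

  deg-─-≤ : ∀ S {x y} → S y ≡ true → deg S x ≤ suc (deg (S ─ y) x)
  deg-─-≤ S {x} {y} y∈ rewrite sumOver-─ S (λ w → 𝟙 (adj x w)) y∈ =
    +-monoˡ-≤ (deg (S ─ y) x) (𝟙≤1 (adj x y))

  arcs-─ : ∀ S {v} → S v ≡ true → arcs S ≡ arcs (S ─ v) + deg (S ─ v) v
  arcs-─ S {v} v∈ = begin
    arcs S                                                  ≡⟨ sumOver-─ S (outdeg S) v∈ ⟩
    outdeg S v + sumOver S′ (outdeg S)                      ≡⟨ cong₂ _+_ (outdeg-─-self S v∈)
                                                                 (sumOver-cong S′ λ _ → sumOver-─ S _ v∈) ⟩
    outdeg S′ v + sumOver S′ (λ y → 𝟙 (arc G y v) + outdeg S′ y)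
                                                            ≡⟨ cong (outdeg S′ v +_) (sumOver-+ S′ _ (outdeg S′)) ⟩
    outdeg S′ v + (indeg S′ v + arcs S′)                    ≡⟨ +-assoc (outdeg S′ v) _ _ ⟨
    outdeg S′ v + indeg S′ v + arcs S′                      ≡⟨ +-comm _ (arcs S′) ⟩
    arcs S′ + (outdeg S′ v + indeg S′ v)                    ≡⟨ cong (arcs S′ +_) (deg≡outdeg+indeg S′ v) ⟨
    arcs S′ + deg S′ v                                      ∎
    where
    open ≡-Reasoning
    S′ : VertexSet n
    S′ = S ─ v

  record Triangle (S : VertexSet n) (a b c : Fin n) : Set where
    field
      a∈ : S a ≡ true
      b∈ : S b ≡ true
      c∈ : S c ≡ true
      ab : adj a b ≡ true
      bc : adj b c ≡ true
      ac : adj a c ≡ true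

  TriangleFree : VertexSet n → Set
  TriangleFree S = ∀ {a b c} → Triangle S a b c → ⊥

  TriangleFree-─ : ∀ S v → TriangleFree S → TriangleFree (S ─ v)
  TriangleFree-─ S v tf t =
    tf (record { a∈ = ─-⊆ S a∈ ; b∈ = ─-⊆ S b∈ ; c∈ = ─-⊆ S c∈ ; ab = ab ; bc = bc ; ac = ac })
    where open Triangle t

  HasTriangle : VertexSet n → Set
  HasTriangle S = ∃ λ a → ∃ λ b → ∃ λ c → Triangle S a b c

  triangle? : ∀ S → Dec (HasTriangle S)
  triangle? S = map′
    (λ (a , b , c , a∈ , b∈ , c∈ , ab , bc , ac) →
      a , b , c , record { a∈ = a∈ ; b∈ = b∈ ; c∈ = c∈ ; ab = ab ; bc = bc ; ac = ac })
    (λ (a , b , c , t) → let open Triangle t in a , b , c , a∈ , b∈ , c∈ , ab , bc , ac)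
    (any? λ a → any? λ b → any? λ c →
      (S a ≟ᵇ true) ×-dec (S b ≟ᵇ true) ×-dec (S c ≟ᵇ true) ×-dec
      (adj a b ≟ᵇ true) ×-dec (adj b c ≟ᵇ true) ×-dec (adj a c ≟ᵇ true))

  common-neighbour : ∀ S u x → size S < deg S u + deg S x →
    ∃ λ z → S z ≡ true × adj u z ≡ true × adj x z ≡ true
  common-neighbour S u x dense with sumOver-positive S common (+-cancelˡ-< (size S) 0 _ count)
    where
    common : Fin n → ℕ
    common z = 𝟙 (adj u z ∧ adj x z)
    count : size S + 0 < size S + sumOver S common
    count = begin-strict
      size S + 0                                            ≡⟨ +-identityʳ (size S) ⟩
      size S                                                <⟨ dense ⟩
      deg S u + deg S x                                     ≡⟨ sumOver-+ S (λ z → 𝟙 (adj u z)) (λ z → 𝟙 (adj x z)) ⟨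
      sumOver S (λ z → 𝟙 (adj u z) + 𝟙 (adj x z))           ≤⟨ sumOver-mono-≤ S (λ {z} _ → 𝟙-+-≤ (adj u z) (adj x z)) ⟩
      sumOver S (λ z → 1 + common z)                        ≡⟨ sumOver-+ S (λ _ → 1) common ⟩
      size S + sumOver S common                             ∎
      where open ≤-Reasoning
  ... | z , z∈ , positive with 𝟙-∧-positive (adj u z) (adj x z) positive
  ...   | uz , xz = z , z∈ , uz , xz

  high-degree⇒¬TriangleFree : ∀ S → size S ≡ suc s →
    (∀ {v} → S v ≡ true → ⌈ s /2⌉ < deg S v) → ¬ TriangleFree S
  high-degree⇒¬TriangleFree {s} S size≡ high tf with size≡suc⇒∈ S size≡
  ... | u , u∈ with sumOver-positive S (λ z → 𝟙 (adj u z)) (≤-trans (s≤s z≤n) (high u∈))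
  ... | x , x∈ , ux with common-neighbour S u x dense
    where
    dense : size S < deg S u + deg S x
    dense = begin-strict
      size S                            ≡⟨ size≡ ⟩
      suc s                             ≤⟨ s≤s (n≤⌈n/2⌉+⌈n/2⌉ s) ⟩
      suc (⌈ s /2⌉ + ⌈ s /2⌉)           <⟨ s≤s (≤-reflexive (sym (+-suc ⌈ s /2⌉ ⌈ s /2⌉))) ⟩
      suc ⌈ s /2⌉ + suc ⌈ s /2⌉         ≤⟨ +-mono-≤ (high u∈) (high x∈) ⟩
      deg S u + deg S x                 ∎
      where open ≤-Reasoning
  ... | z , z∈ , uz , xz =
    tf (record { a∈ = u∈ ; b∈ = x∈ ; c∈ = z∈ ; ab = 𝟙-positive ux ; bc = xz ; ac = uz })

  low-degree-vertex : ∀ S → size S ≡ suc s → TriangleFree S →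
    ∃ λ v → S v ≡ true × deg (S ─ v) v ≤ ⌈ s /2⌉
  low-degree-vertex {s} S size≡ tf with any? (λ v → (S v ≟ᵇ true) ×-dec (deg S v ≤? ⌈ s /2⌉))
  ... | yes (v , v∈ , low) = v , v∈ , subst (_≤ ⌈ s /2⌉) (deg-─-self S v∈) low
  ... | no ∄low = ⊥-elim (high-degree⇒¬TriangleFree S size≡ (λ {v} v∈ → ≰⇒> λ low → ∄low (v , v∈ , low)) tf)

  mantel-bound : ∀ s S → size S ≡ s → TriangleFree S → arcs S ≤ mantel s
  mantel-bound zero    S size≡ _  = ≤-reflexive (sumOver-empty S (outdeg S) size≡)
  mantel-bound (suc s) S size≡ tf with low-degree-vertex S size≡ tf
  ... | v , v∈ , low = begin
    arcs S                            ≡⟨ arcs-─ S v∈ ⟩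
    arcs (S ─ v) + deg (S ─ v) v      ≤⟨ +-mono-≤ (mantel-bound s (S ─ v) (size≡suc⇒size-─≡ S v∈ size≡)
                                                                 (TriangleFree-─ S v tf)) low ⟩
    mantel s + ⌈ s /2⌉                ≡⟨ mantel-suc s ⟨
    mantel (suc s)                    ∎
    where open ≤-Reasoning

  Bipartition : VertexSet n → (Fin n → Bool) → Set
  Bipartition S side = ∀ {u w} → S u ≡ true → S w ≡ true → adj u w ≡ side u xor side w

  record BalancedBipartition (S : VertexSet n) (s : ℕ) : Set where
    field
      side      : Fin n → Bool
      bipartite : Bipartition S side
      #true     : countOn S side ≡ ⌈ s /2⌉
      #false    : countOn S (not ∘ side) ≡ ⌊ s /2⌋

  bipartition-not : ∀ {S side} → Bipartition S side → Bipartition S (not ∘ side)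
  bipartition-not {side = side} bip {u} {w} u∈ w∈ = trans (bip u∈ w∈) (sym (not-xor-not (side u) (side w)))
    where
    not-xor-not : ∀ a b → not a xor not b ≡ a xor b
    not-xor-not a b = trans (sym (not-distribˡ-xor a (not b)))
                            (trans (cong not (sym (not-distribʳ-xor a b))) (not-involutive (a xor b)))

  neighbours-one-sided : ∀ S {v side} → S v ≡ true → TriangleFree S → Bipartition (S ─ v) side →
    ∃ λ b → ∀ {y} → (S ─ v) y ≡ true → adj v y ≡ true → side y ≡ b
  neighbours-one-sided S {v} {side} v∈ tf bip
    with any? (λ x → ((S ─ v) x ≟ᵇ true) ×-dec (adj v x ≟ᵇ true) ×-dec (side x ≟ᵇ false))
  ... | yes (x , x∈ , vx , x-false) = false , all-false
    where
    all-false : ∀ {y} → (S ─ v) y ≡ true → adj v y ≡ true → side y ≡ false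
    all-false {y} y∈ vy with side y in y-true
    ... | false = refl
    ... | true  = ⊥-elim (tf (record
      { a∈ = v∈ ; b∈ = ─-⊆ S x∈ ; c∈ = ─-⊆ S y∈ ; ab = vx ; ac = vy
      ; bc = trans (bip x∈ y∈) (cong₂ _xor_ x-false y-true) }))
  ... | no ∄false = true , all-true
    where
    all-true : ∀ {y} → (S ─ v) y ≡ true → adj v y ≡ true → side y ≡ true
    all-true {y} y∈ vy with side y in y-side
    ... | true  = refl
    ... | false = ⊥-elim (∄false (y , y∈ , vy , y-side))

  𝟙-adj≤𝟙-not-side : ∀ (T : VertexSet n) {v : Fin n} {side : Fin n → Bool} →
    (∀ {y} → T y ≡ true → adj v y ≡ true → side y ≡ false) →
    ∀ {y} → T y ≡ true → 𝟙 (adj v y) ≤ 𝟙 (not (side y))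
  𝟙-adj≤𝟙-not-side T {v} {side} off {y} y∈ with adj v y in vy
  ... | false = z≤n
  ... | true rewrite off y∈ vy = ≤-refl

  countOn-insert : ∀ S {v} (side : Fin n → Bool) (b : Bool) → S v ≡ true →
    countOn S (side [ v ↦ b ]) ≡ 𝟙 b + countOn (S ─ v) side
  countOn-insert S {v} side b v∈ =
    trans (sumOver-─ S (𝟙 ∘ side [ v ↦ b ]) v∈)
          (cong₂ _+_ (cong 𝟙 ([↦]-≡ side v b)) (sumOver-cong (S ─ v) λ y∈ → cong 𝟙 ([↦]-≢ side b (─-≢ S y∈))))

  countOn-not-insert : ∀ S {v} (side : Fin n → Bool) (b : Bool) → S v ≡ true →
    countOn S (not ∘ side [ v ↦ b ]) ≡ 𝟙 (not b) + countOn (S ─ v) (not ∘ side)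
  countOn-not-insert S {v} side b v∈ =
    trans (sumOver-─ S (𝟙 ∘ not ∘ side [ v ↦ b ]) v∈)
          (cong₂ _+_ (cong (𝟙 ∘ not) ([↦]-≡ side v b))
                     (sumOver-cong (S ─ v) λ y∈ → cong (𝟙 ∘ not) ([↦]-≢ side b (─-≢ S y∈))))

  bipartition-insert : ∀ S {v side} → S v ≡ true → Bipartition (S ─ v) side →
    (∀ {y} → (S ─ v) y ≡ true → adj v y ≡ not (side y)) → Bipartition S (side [ v ↦ true ])
  bipartition-insert S {v} {side} v∈ bip nbr {u} {w} u∈ w∈ with u ≟ v | w ≟ v
  ... | yes refl | yes refl = adj-irrefl v
  ... | yes refl | no w≢v   = nbr (─-intro S w∈ w≢v)
  ... | no u≢v   | yes refl = trans (adj-sym u v) (trans (nbr (─-intro S u∈ u≢v))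
                                 (sym (trans (xor-comm (side u) true) (true-xor (side u)))))
  ... | no u≢v   | no w≢v   = bip (─-intro S u∈ u≢v) (─-intro S w∈ w≢v)

  -- v joins the true side, so the true side of S ─ v has to be the smaller one.
  insert-vertex : ∀ S {v s} (side : Fin n → Bool) → S v ≡ true → Bipartition (S ─ v) side →
    countOn (S ─ v) side ≡ ⌊ s /2⌋ → countOn (S ─ v) (not ∘ side) ≡ ⌈ s /2⌉ →
    (∀ {y} → (S ─ v) y ≡ true → adj v y ≡ true → side y ≡ false) →
    deg (S ─ v) v ≡ ⌈ s /2⌉ → BalancedBipartition S (suc s)
  insert-vertex S {v} side v∈ bip #on #off off deg≡ = record
    { side      = side [ v ↦ true ]
    ; bipartite = bipartition-insert S v∈ bip (𝟙-injective ∘ neighbours≡off)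
    ; #true     = trans (countOn-insert S side true v∈) (cong suc #on)
    ; #false    = trans (countOn-not-insert S side true v∈) #off
    }
    where
    neighbours≡off : ∀ {y} → (S ─ v) y ≡ true → 𝟙 (adj v y) ≡ 𝟙 (not (side y))
    neighbours≡off = sumOver-mono-≤-≡ (S ─ v) (𝟙-adj≤𝟙-not-side (S ─ v) off) (trans deg≡ (sym #off))

  extend-balanced : ∀ S {v s} → S v ≡ true → TriangleFree S → deg (S ─ v) v ≡ ⌈ s /2⌉ →
    BalancedBipartition (S ─ v) s → BalancedBipartition S (suc s)
  extend-balanced S {v} {s} v∈ tf deg≡
    record { side = side ; bipartite = bip ; #true = #true ; #false = #false }
    with neighbours-one-sided S v∈ tf bip
  ... | true , on =
    insert-vertex S (not ∘ side) v∈ (bipartition-not {side = side} bip) #false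
      (trans (sumOver-cong (S ─ v) λ {y} _ → cong 𝟙 (not-involutive (side y))) #true)
      (λ y∈ vy → cong not (on y∈ vy)) deg≡
  ... | false , off =
    -- the ⌈ s /2⌉ neighbours of v lie in the false side of size ⌊ s /2⌋, so the sides are equal
    insert-vertex S side v∈ bip (trans #true ⌈≡⌊) (trans #false (sym ⌈≡⌊)) off deg≡
    where
    ⌈≡⌊ : ⌈ s /2⌉ ≡ ⌊ s /2⌋
    ⌈≡⌊ = ≤-antisym (begin
      ⌈ s /2⌉                       ≡⟨ deg≡ ⟨
      deg (S ─ v) v                 ≤⟨ sumOver-mono-≤ (S ─ v) (𝟙-adj≤𝟙-not-side (S ─ v) off) ⟩
      countOn (S ─ v) (not ∘ side)  ≡⟨ #false ⟩
      ⌊ s /2⌋                       ∎) (⌊n/2⌋≤⌈n/2⌉ s)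
      where open ≤-Reasoning

  mantel-extremal : ∀ s S → size S ≡ s → TriangleFree S → arcs S ≡ mantel s → BalancedBipartition S s
  mantel-extremal zero S size≡ _ _ = record
    { side      = λ _ → true
    ; bipartite = λ {u} u∈ _ → contradiction (trans (sym u∈) (size≡0⇒∉ S size≡ u)) λ ()
    ; #true     = sumOver-empty S _ size≡
    ; #false    = sumOver-empty S _ size≡
    }
  mantel-extremal (suc s) S size≡ tf tight with low-degree-vertex S size≡ tf
  ... | v , v∈ , low =
    extend-balanced S v∈ tf (proj₂ tight-parts) (mantel-extremal s (S ─ v) size′ tf′ (proj₁ tight-parts))
    where
    size′ : size (S ─ v) ≡ s
    size′ = size≡suc⇒size-─≡ S v∈ size≡
    tf′ : TriangleFree (S ─ v)
    tf′ = TriangleFree-─ S v tf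
    tight-parts : arcs (S ─ v) ≡ mantel s × deg (S ─ v) v ≡ ⌈ s /2⌉
    tight-parts = +-mono-≤-≡ (mantel-bound s (S ─ v) size′ tf′) low
      (trans (sym (arcs-─ S v∈)) (trans tight (mantel-suc s)))

-- Triangles in 2-geodetic digraphs

NoTransitiveTriangle : Digraph n → Set
NoTransitiveTriangle G = ∀ {u v w} → arc G u v ≡ true → arc G v w ≡ true → arc G u w ≡ true → ⊥

UniqueTwoPaths : Digraph n → Set
UniqueTwoPaths G = ∀ {u v w x} →
  arc G u v ≡ true → arc G v w ≡ true → arc G u x ≡ true → arc G x w ≡ true → v ≡ x

module TwoGeodetic {n : ℕ} (G : Digraph n) (asym : Asymmetric G)
  (no-transitive : NoTransitiveTriangle G) (unique-paths : UniqueTwoPaths G) where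

  open Orientation G asym public

  triangle-cyclic : ∀ {a b c} → adj a b ≡ true → adj b c ≡ true → adj a c ≡ true →
    (arc G a b ≡ true × arc G b c ≡ true × arc G c a ≡ true) ⊎
    (arc G b a ≡ true × arc G c b ≡ true × arc G a c ≡ true)
  triangle-cyclic ab bc ac with adj⇒arc ab | adj⇒arc bc | adj⇒arc ac
  ... | inj₁ a→b | inj₁ b→c | inj₂ c→a = inj₁ (a→b , b→c , c→a)
  ... | inj₂ b→a | inj₂ c→b | inj₁ a→c = inj₂ (b→a , c→b , a→c)
  ... | inj₁ a→b | inj₁ b→c | inj₁ a→c = ⊥-elim (no-transitive a→b b→c a→c)
  ... | inj₁ a→b | inj₂ c→b | inj₁ a→c = ⊥-elim (no-transitive a→c c→b a→b)
  ... | inj₁ a→b | inj₂ c→b | inj₂ c→a = ⊥-elim (no-transitive c→a a→b c→b)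
  ... | inj₂ b→a | inj₁ b→c | inj₁ a→c = ⊥-elim (no-transitive b→a a→c b→c)
  ... | inj₂ b→a | inj₁ b→c | inj₂ c→a = ⊥-elim (no-transitive b→c c→a b→a)
  ... | inj₂ b→a | inj₂ c→b | inj₂ c→a = ⊥-elim (no-transitive c→b b→a c→a)

  -- The two triangles on an edge uv would be cyclic in the same sense, giving two u,v-paths or two
  -- v,u-paths of length two; in opposite senses, uv would be a 2-cycle.
  edge-in-unique-triangle : ∀ {u v x y} → adj u v ≡ true →
    adj u x ≡ true → adj v x ≡ true → adj u y ≡ true → adj v y ≡ true → x ≡ y
  edge-in-unique-triangle uv ux vx uy vy with triangle-cyclic uv vx ux | triangle-cyclic uv vy uy
  ... | inj₁ (_ , v→x , x→u) | inj₁ (_ , v→y , y→u) = unique-paths v→x x→u v→y y→u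
  ... | inj₂ (_ , x→v , u→x) | inj₂ (_ , y→v , u→y) = unique-paths u→x x→v u→y y→v
  ... | inj₁ (u→v , _) | inj₂ (v→u , _) = ⊥-elim (asym u→v v→u)
  ... | inj₂ (v→u , _) | inj₁ (u→v , _) = ⊥-elim (asym u→v v→u)

  remove-triangle : ∀ S {u v w} → Triangle S u v w → let T = S ─ u ─ v ─ w in
    size S ≡ 3 + size T × arcs S ≤ arcs T + (3 + size T)
  remove-triangle S {u} {v} {w} t = size≡ , arcs≤
    where
    open Triangle t renaming (a∈ to u∈; b∈ to v∈; c∈ to w∈; ab to uv; bc to vw; ac to uw)
    vu : adj v u ≡ true
    vu = trans (adj-sym v u) uv
    wu : adj w u ≡ true
    wu = trans (adj-sym w u) uw
    wv : adj w v ≡ true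
    wv = trans (adj-sym w v) vw
    S₁ S₂ T : VertexSet n
    S₁ = S ─ u
    S₂ = S₁ ─ v
    T  = S₂ ─ w
    v∈₁ : S₁ v ≡ true
    v∈₁ = ─-intro S v∈ (adj⇒≢ vu)
    w∈₁ : S₁ w ≡ true
    w∈₁ = ─-intro S w∈ (adj⇒≢ wu)
    w∈₂ : S₂ w ≡ true
    w∈₂ = ─-intro S₁ w∈₁ (adj⇒≢ wv)

    size≡ : size S ≡ 3 + size T
    size≡ = trans (size-─ S u∈) (cong suc (trans (size-─ S₁ v∈₁) (cong suc (size-─ S₂ w∈₂))))

    outside : ∀ {y} → T y ≡ true → y ≢ u × y ≢ v × y ≢ w
    outside {y} y∈ = ─-≢ S {u} {y} (─-⊆ S₁ {v} {y} (─-⊆ S₂ {w} {y} y∈)) , ─-≢ S₁ {v} {y} (─-⊆ S₂ {w} {y} y∈) ,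
                     ─-≢ S₂ {w} {y} y∈

    adjacent-to-one : ∀ {y} → T y ≡ true → 𝟙 (adj u y) + (𝟙 (adj v y) + 𝟙 (adj w y)) ≤ 1
    adjacent-to-one {y} y∈ with outside y∈ | adj u y in uy | adj v y in vy | adj w y in wy
    ... | y≢u , y≢v , y≢w | true  | true  | _     = ⊥-elim (y≢w (sym (edge-in-unique-triangle uv uw vw uy vy)))
    ... | y≢u , y≢v , y≢w | true  | false | true  = ⊥-elim (y≢v (sym (edge-in-unique-triangle uw uv wv uy wy)))
    ... | y≢u , y≢v , y≢w | false | true  | true  = ⊥-elim (y≢u (sym (edge-in-unique-triangle vw vu wu vy wy)))
    ... | _ | true  | false | false = ≤-refl
    ... | _ | false | true  | false = ≤-refl
    ... | _ | false | false | true  = ≤-refl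
    ... | _ | false | false | false = z≤n

    degrees≤ : deg T u + (deg T v + deg T w) ≤ size T
    degrees≤ = begin
      deg T u + (deg T v + deg T w)  ≡⟨ cong (deg T u +_) (sumOver-+ T (λ y → 𝟙 (adj v y)) (λ y → 𝟙 (adj w y))) ⟨
      deg T u + sumOver T (λ y → 𝟙 (adj v y) + 𝟙 (adj w y))
                                     ≡⟨ sumOver-+ T (λ y → 𝟙 (adj u y)) _ ⟨
      sumOver T (λ y → 𝟙 (adj u y) + (𝟙 (adj v y) + 𝟙 (adj w y)))
                                     ≤⟨ sumOver-mono-≤ T adjacent-to-one ⟩
      size T                         ∎
      where open ≤-Reasoning

    arcs≤ : arcs S ≤ arcs T + (3 + size T)
    arcs≤ = begin
      arcs S                                          ≡⟨ arcs-─ S u∈ ⟩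
      arcs S₁ + deg S₁ u                              ≡⟨ cong (_+ deg S₁ u) (arcs-─ S₁ v∈₁) ⟩
      arcs S₂ + deg S₂ v + deg S₁ u                   ≡⟨ cong (λ a → a + deg S₂ v + deg S₁ u) (arcs-─ S₂ w∈₂) ⟩
      arcs T + deg T w + deg S₂ v + deg S₁ u          ≤⟨ +-mono-≤ (+-monoʳ-≤ (arcs T + deg T w) (deg-─-≤ S₂ w∈₂))
                                                            (≤-trans (deg-─-≤ S₁ v∈₁) (s≤s (deg-─-≤ S₂ w∈₂))) ⟩
      arcs T + deg T w + suc (deg T v) + suc (suc (deg T u))
                                                      ≡⟨ regroup (arcs T) (deg T u) (deg T v) (deg T w) ⟩
      arcs T + (3 + (deg T u + (deg T v + deg T w)))  ≤⟨ +-monoʳ-≤ (arcs T) (+-monoʳ-≤ 3 degrees≤) ⟩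
      arcs T + (3 + size T)                           ∎
      where
      open ≤-Reasoning
      regroup : ∀ a x y z → a + z + suc y + suc (suc x) ≡ a + (3 + (x + (y + z)))
      regroup = solve-∀

  arcs≤geodeticBound : ∀ S → arcs S ≤ geodeticBound (size S)
  arcs≤geodeticBound S = <-rec P bound (size S) S refl
    where
    P : ℕ → Set
    P s = ∀ S → size S ≡ s → arcs S ≤ geodeticBound s
    bound : ∀ s → (∀ {t} → t < s → P t) → P s
    bound s smaller S size≡ with triangle? S
    ... | no ∄triangle =
      ≤-trans (mantel-bound s S size≡ (λ t → ∄triangle (_ , _ , _ , t))) (mantel≤geodeticBound s)
    ... | yes (u , v , w , t) with remove-triangle S t
    ...   | size≡3+ , arcs≤ = begin
      arcs S                                ≤⟨ arcs≤ ⟩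
      arcs T + (3 + size T)                 ≤⟨ +-monoˡ-≤ (3 + size T) (smaller T<s T refl) ⟩
      geodeticBound (size T) + (3 + size T) ≤⟨ geodeticBound-3+ (size T) ⟩
      geodeticBound (3 + size T)            ≡⟨ cong geodeticBound (trans (sym size≡3+) size≡) ⟩
      geodeticBound s                       ∎
      where
      open ≤-Reasoning
      T : VertexSet n
      T = S ─ u ─ v ─ w
      T<s : size T < s
      T<s = subst (size T <_) (trans (sym size≡3+) size≡) (m<n+m (size T) z<s)

  triangle⇒arcs<mantel : ∀ S {u v w} → Triangle S u v w → 7 ≤ size S → arcs S < mantel (size S)
  triangle⇒arcs<mantel S {u} {v} {w} t 7≤ with remove-triangle S t
  ... | size≡ , arcs≤ = begin-strict
    arcs S                                ≤⟨ arcs≤ ⟩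
    arcs T + (3 + size T)                 ≤⟨ +-monoˡ-≤ (3 + size T) (arcs≤geodeticBound T) ⟩
    geodeticBound (size T) + (3 + size T) ≡⟨ cong (_+ (3 + size T)) (geodeticBound≡mantel 4≤T) ⟩
    mantel (size T) + (3 + size T)        <⟨ mantel-3+-< (size T) (≤-trans (m≤n⇒m≤1+n ≤-refl) 4≤T) ⟩
    mantel (3 + size T)                   ≡⟨ cong mantel size≡ ⟨
    mantel (size S)                       ∎
    where
    open ≤-Reasoning
    T : VertexSet n
    T = S ─ u ─ v ─ w
    4≤T : 4 ≤ size T
    4≤T = +-cancelˡ-≤ 3 4 (size T) (subst (7 ≤_) size≡ 7≤)

module KGeodetic {n k : ℕ} {G : Digraph n} (2≤k : 2 ≤ k) (geodetic : Geodetic k G) where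

  geodetic⇒asymmetric : Asymmetric G
  geodetic⇒asymmetric {u} {v} u→v v→u
    with geodetic u u _ _ (here u) (step u→v (step v→u (here u))) (s≤s z≤n) (s≤s 2≤k)
  ... | ()

  geodetic⇒no-transitive : NoTransitiveTriangle G
  geodetic⇒no-transitive {u} {v} {w} u→v v→w u→w
    with geodetic u w _ _ (step u→v (step v→w (here w))) (step u→w (here w)) (s≤s 2≤k) (m≤n⇒m≤1+n 2≤k)
  ... | ()

  geodetic⇒unique-paths : UniqueTwoPaths G
  geodetic⇒unique-paths {u} {v} {w} {x} u→v v→w u→x x→w
    with geodetic u w _ _ (step u→v (step v→w (here w))) (step u→x (step x→w (here w))) (s≤s 2≤k) (s≤s 2≤k)
  ... | refl = refl

  open TwoGeodetic G geodetic⇒asymmetric geodetic⇒no-transitive geodetic⇒unique-paths public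

geodetic-arcCount≤ : ∀ {k} (G : Digraph n) → 2 ≤ k → Geodetic k G → arcCount G ≤ geodeticBound n
geodetic-arcCount≤ {n} G 2≤k geodetic = begin
  arcCount G                     ≡⟨ arcCount≡sum G ⟩
  arcs (full n)                  ≤⟨ arcs≤geodeticBound (full n) ⟩
  geodeticBound (size (full n))  ≡⟨ cong geodeticBound (size-full n) ⟩
  geodeticBound n                ∎
  where
  open ≤-Reasoning
  open KGeodetic 2≤k geodetic

-- Extremal digraphs

sum-𝟙+sum-𝟙-not : (p : Fin n → Bool) → sum (𝟙 ∘ p) + sum (𝟙 ∘ not ∘ p) ≡ n
sum-𝟙+sum-𝟙-not {n} p = trans (sym (∑-distrib-+ (𝟙 ∘ p) (𝟙 ∘ not ∘ p)))
                              (trans (sum-cong-≗ λ v → 𝟙+𝟙-not (p v)) (sum-const-1 n))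
  where
  𝟙+𝟙-not : ∀ b → 𝟙 b + 𝟙 (not b) ≡ 1
  𝟙+𝟙-not true  = refl
  𝟙+𝟙-not false = refl

sum-𝟙-<ᵇ : ∀ {m} h → h ≤ m → sum {m} (λ i → 𝟙 (toℕ i <ᵇ h)) ≡ h
sum-𝟙-<ᵇ {m}     zero    _         = sum-replicate-zero m
sum-𝟙-<ᵇ {suc m} (suc h) (s≤s h≤m) = cong suc (sum-𝟙-<ᵇ h h≤m)

module CompleteBipartiteOrientation {n : ℕ} (side : Fin n → Bool) where

  digraph : Digraph n
  digraph = record { arc = λ u v → side u ∧ not (side v) ; irrefl = λ u → ∧-inverseʳ (side u) }

  no-path-of-length-two : ∀ {u w v} → arc digraph u w ≡ true → arc digraph w v ≡ true → ⊥
  no-path-of-length-two {u} {w} _  _  with side u | side w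
  no-path-of-length-two         () _  | false | _
  no-path-of-length-two         () _  | true  | true
  no-path-of-length-two         _  () | true  | false

  no-loop : ∀ {u} → arc digraph u u ≡ true → ⊥
  no-loop {u} loop with trans (sym loop) (irrefl digraph u)
  ... | ()

  walk-shape : ∀ {u v xs} → Walk digraph u v xs →
    (xs ≡ u ∷ [] × u ≡ v) ⊎ (xs ≡ u ∷ v ∷ [] × arc digraph u v ≡ true)
  walk-shape (here u)              = inj₁ (refl , refl)
  walk-shape (step uv (here _))    = inj₂ (refl , uv)
  walk-shape (step uw (step wv _)) = ⊥-elim (no-path-of-length-two uw wv)

  geodetic : ∀ k → Geodetic k digraph
  geodetic _ _ _ _ _ p q _ _ with walk-shape p | walk-shape q
  ... | inj₁ (refl , _)    | inj₁ (refl , _)    = refl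
  ... | inj₂ (refl , _)    | inj₂ (refl , _)    = refl
  ... | inj₁ (_ , refl)    | inj₂ (_ , loop)    = ⊥-elim (no-loop loop)
  ... | inj₂ (_ , loop)    | inj₁ (_ , refl)    = ⊥-elim (no-loop loop)

  arcCount≡ : arcCount digraph ≡ countTrue side * countFalse side
  arcCount≡ = begin
    arcCount digraph                                    ≡⟨ arcCount≡sum digraph ⟩
    sum (λ u → sum (λ v → 𝟙 (side u ∧ not (side v))))  ≡⟨ sum-cong-≗ row ⟩
    sum (λ u → 𝟙 (side u) * #false)                    ≡⟨ *-distribʳ-sum #false (𝟙 ∘ side) ⟨
    sum (𝟙 ∘ side) * #false                            ≡⟨ cong₂ _*_ (countTrue≡sum side) (countFalse≡sum side) ⟨
    countTrue side * countFalse side                    ∎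
    where
    open ≡-Reasoning
    #false : ℕ
    #false = sum (𝟙 ∘ not ∘ side)
    row : ∀ u → sum (λ v → 𝟙 (side u ∧ not (side v))) ≡ 𝟙 (side u) * #false
    row u with side u
    ... | true  = sym (+-identityʳ _)
    ... | false = sum-replicate-zero n

mantel-attained : ∀ n → Σ (Digraph n) λ G → (∀ k → Geodetic k G) × arcCount G ≡ mantel n
mantel-attained n = digraph , geodetic , trans arcCount≡ (cong₂ _*_ #lower #upper)
  where
  lower : Fin n → Bool
  lower i = toℕ i <ᵇ ⌊ n /2⌋
  open CompleteBipartiteOrientation lower
  sum-lower : sum (𝟙 ∘ lower) ≡ ⌊ n /2⌋
  sum-lower = sum-𝟙-<ᵇ ⌊ n /2⌋ (⌊n/2⌋≤n n)
  #lower : countTrue lower ≡ ⌊ n /2⌋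
  #lower = trans (countTrue≡sum lower) sum-lower
  #upper : countFalse lower ≡ ⌈ n /2⌉
  #upper = +-cancelˡ-≡ ⌊ n /2⌋ _ _ (begin
    ⌊ n /2⌋ + countFalse lower                 ≡⟨ cong₂ _+_ sum-lower (sym (countFalse≡sum lower)) ⟨
    sum (𝟙 ∘ lower) + sum (𝟙 ∘ not ∘ lower)    ≡⟨ sum-𝟙+sum-𝟙-not lower ⟩
    n                                          ≡⟨ ⌊n/2⌋+⌈n/2⌉≡n n ⟨
    ⌊ n /2⌋ + ⌈ n /2⌉                          ∎)
    where open ≡-Reasoning

geodetic-extremal : ∀ {k} (G : Digraph n) → 2 ≤ k → Geodetic k G → 7 ≤ n → arcCount G ≡ mantel n →
  IsOrientationOfKbip ⌈ n /2⌉ ⌊ n /2⌋ G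
geodetic-extremal {n} G 2≤k geodetic 7≤n tight =
  side , trans (countTrue≡sum side) #true , trans (countFalse≡sum side) #false ,
  λ u v → bipartite refl refl , arc∧arc≡false u v
  where
  open KGeodetic 2≤k geodetic
  arcs≡ : arcs (full n) ≡ mantel (size (full n))
  arcs≡ = trans (sym (arcCount≡sum G)) (trans tight (cong mantel (sym (size-full n))))
  triangle-free : TriangleFree (full n)
  triangle-free t = <-irrefl arcs≡ (triangle⇒arcs<mantel (full n) t (subst (7 ≤_) (sym (size-full n)) 7≤n))
  open BalancedBipartition
    (mantel-extremal n (full n) (size-full n) triangle-free (trans arcs≡ (cong mantel (size-full n))))

IsEx-unique : ∀ {n k a b} → IsEx n k a → IsEx n k b → a ≡ b
IsEx-unique ((G , geodetic , G-arcs) , a-max) ((H , geodetic′ , H-arcs) , b-max) =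
  ≤-antisym (subst (_≤ _) G-arcs (b-max G geodetic)) (subst (_≤ _) H-arcs (a-max H geodetic′))

ex≡mantel : ∀ {n k} → 4 ≤ n → 2 ≤ k → IsEx n k (mantel n)
ex≡mantel {n} {k} 4≤n 2≤k =
  let G , geodetic , G-arcs = mantel-attained n in
  (G , geodetic k , G-arcs) , λ H H-geodetic →
    subst (arcCount H ≤_) (geodeticBound≡mantel 4≤n) (geodetic-arcCount≤ H 2≤k H-geodetic)

theorem10 :
    ((n k : ℕ) → 4 ≤ n → 2 ≤ k → IsEx n k ((n * n) / 4)) ×
    ((n m : ℕ) → 7 ≤ n → IsEx n 2 m →
      (G : Digraph n) → Geodetic 2 G → arcCount G ≡ m →
      IsOrientationOfKbip ⌈ n /2⌉ ⌊ n /2⌋ G)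
theorem10 =
  (λ n k 4≤n 2≤k → subst (IsEx n k) (mantel≡square/4 n) (ex≡mantel 4≤n 2≤k)) ,
  λ n m 7≤n ex G geodetic G-arcs →
    geodetic-extremal G ≤-refl geodetic 7≤n
      (trans G-arcs (IsEx-unique ex (ex≡mantel (≤-trans (m≤m+n 4 3) 7≤n) ≤-refl)))
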